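{- For every natural graph $G$, $$\kappa(G)\le (\chi(G))^{|V(G)|},$$ where $\chi(G)$ is the chromatic number of $G$. In particular $\kappa(G)$ is finite.
   Context: A natural graph is a simple graph (no loops, no multiple edges) whose vertex set is a finite subset of $\mathbb{N}=\{1,2,\dots\}$. An infinite permutation of $\mathbb{N}$ is a linear ordering of all elements of $\mathbb{N}$, written as a sequence $\pi=(\pi(1),\pi(2),\dots)$ in which every positive integer occurs exactly once. For a natural graph $G$, two infinite permutations $\pi,\sigma$ are $G$-different if there is some $i\in\mathbb{N}$ with $\{\pi(i),\sigma(i)\}\in E(G)$. $\kappa(G)$ denotes the maximum cardinality of a set of infinite permutations any two distinct elements of which are $G$-different. -}

module Defs where

open import Data.Nat using (ℕ; _≤_)
open import Data.Fin using (Fin)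
open import Data.List using (List; length)
open import Data.List.Membership.Propositional using (_∈_)
open import Data.List.Relation.Unary.All using (All)
open import Data.List.Relation.Unary.Unique.Propositional using (Unique)
open import Data.Product using (Σ; ∃; _×_)
open import Relation.Binary.PropositionalEquality using (_≡_; _≢_)
open import Relation.Nullary using (¬_)

-- A natural graph: a simple graph whose vertex set is a finite subset of
-- ℕ = {1,2,...}.
record NaturalGraph : Set₁ where
  field
    V        : List ℕ
    V-unique : Unique V
    V-pos    : All (1 ≤_) V
    E        : ℕ → ℕ → Set
    E-sym    : ∀ {u v} → E u v → E v u
    E-irrefl : ∀ {u} → ¬ E u u
    E-in-V   : ∀ {u v} → E u v → (u ∈ V) × (v ∈ V)

open NaturalGraph public

∣V∣ : NaturalGraph → ℕ
∣V∣ G = length (V G)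

-- a proper colouring with k colours (values outside V(G) are irrelevant)
Colourable : NaturalGraph → ℕ → Set
Colourable G k = Σ (ℕ → Fin k) λ c → ∀ {u v} → E G u v → c u ≢ c v

IsChromaticNumber : NaturalGraph → ℕ → Set
IsChromaticNumber G χ = Colourable G χ × (∀ k → Colourable G k → χ ≤ k)

-- An infinite permutation of ℕ = {1,2,...}: the sequence (π 1, π 2, ...),
-- a bijection from positive integers onto positive integers
-- (the value at 0 is irrelevant and ignored).
record InfPerm : Set where
  field
    π    : ℕ → ℕ
    pos  : ∀ i → 1 ≤ i → 1 ≤ π i
    inj  : ∀ i j → 1 ≤ i → 1 ≤ j → π i ≡ π j → i ≡ j
    surj : ∀ n → 1 ≤ n → Σ ℕ λ i → (1 ≤ i) × (π i ≡ n)

open InfPerm public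

GDifferent : NaturalGraph → InfPerm → InfPerm → Set
GDifferent G p s = Σ ℕ λ i → (1 ≤ i) × E G (π p i) (π s i)

module Submission where

-- Fix a proper χ-colouring of G.  Reading a permutation at the positions where it
-- takes a value in V(G), and colouring those values, gives a partial colouring of
-- the positions with at most |V(G)| coloured points; two G-different permutations
-- give partial colourings that clash, i.e. colour some common position differently.
-- On a finite window of w positions containing a clash for every pair, a Kraft-type
-- inequality for pairwise clashing partial colourings, Σ_f χ^(number of uncoloured
-- positions of f) ≤ χ^w, then yields m · χ^(w − |V(G)|) ≤ χ^w.

open import Algebra.Properties.CommutativeSemigroup using (interchange)
open import Data.Bool using (true; false; if_then_else_)
open import Data.Fin using (Fin; _≟_)
open import Data.List using (List; []; _∷_; _++_; [_]; length; map; filter; allFin; upTo)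
open import Data.List.Membership.Propositional using (_∈_; lose)
open import Data.List.Membership.Propositional.Properties
  using (∈-∃++; ∈-++⁻; ∈-++⁺ˡ; ∈-++⁺ʳ; ∈-allFin; ∈-upTo⁺)
open import Data.List.Properties
  using (length-map; length-tabulate; length-++-sucʳ; map-cong; map-∘; filter-accept; filter-reject; filter-none)
open import Data.List.Relation.Binary.Subset.Propositional using (_⊆_)
open import Data.List.Relation.Unary.All as All using (All; []; _∷_)
import Data.List.Relation.Unary.All.Properties as All
open import Data.List.Relation.Unary.AllPairs using (AllPairs; []; _∷_)
import Data.List.Relation.Unary.AllPairs.Properties as AllPairs
open import Data.List.Relation.Unary.Any as Any using (Any; here; there)
open import Data.List.Relation.Unary.Unique.Propositional using (Unique)
import Data.List.Relation.Unary.Unique.Propositional.Properties as Unique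
open import Data.Maybe using (Maybe; just; nothing)
open import Data.Nat as ℕ using (ℕ; zero; suc; _+_; _*_; _≤_; _^_; z≤n; s≤s; NonZero)
open import Data.Nat.ListAction using (sum)
open import Data.List.Membership.DecPropositional ℕ._≟_ using (_∈?_)
open import Data.Nat.Properties
  using ( ≤-refl; ≤-reflexive; ≤-trans; module ≤-Reasoning; suc-injective
        ; +-suc; +-identityʳ; +-commutativeSemigroup; +-mono-≤; +-monoʳ-≤; m≤m+n; m≤n+m
        ; *-comm; *-zeroʳ; *-distribʳ-+; *-monoˡ-≤; *-cancelʳ-≤
        ; ^-distribˡ-+-*; ^-monoʳ-≤; m^n≢0 )
open import Data.Product using (∃; ∃₂; _×_; _,_; proj₁)
open import Data.Sum using (inj₁; inj₂)
open import Data.Unit using (⊤; tt)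
open import Function using (_∘_; id)
open import Level using (Level)
open import Relation.Binary.Definitions using (DecidableEquality)
open import Relation.Binary.PropositionalEquality
  using (_≡_; _≢_; refl; sym; trans; cong; subst; module ≡-Reasoning)
open import Relation.Nullary using (¬_; Dec; yes; no; does; contradiction)
open import Relation.Unary using (Pred; Decidable)

open import Defs

private
  variable
    a b : Level
    A : Set a
    B : Set b

sum-map-const : ∀ n (xs : List A) → sum (map (λ _ → n) xs) ≡ length xs * n
sum-map-const n []       = refl
sum-map-const n (x ∷ xs) = cong (n +_) (sum-map-const n xs)

sum-map-+ : ∀ (f g : A → ℕ) xs →
            sum (map (λ x → f x + g x) xs) ≡ sum (map f xs) + sum (map g xs)
sum-map-+ f g []       = refl
sum-map-+ f g (x ∷ xs) = begin
  f x + g x + sum (map (λ x → f x + g x) xs)     ≡⟨ cong (f x + g x +_) (sum-map-+ f g xs) ⟩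
  f x + g x + (sum (map f xs) + sum (map g xs))  ≡⟨ interchange +-commutativeSemigroup (f x) (g x) _ _ ⟩
  f x + sum (map f xs) + (g x + sum (map g xs))  ∎
  where open ≡-Reasoning

sum-map-*ʳ : ∀ (f : A → ℕ) n xs → sum (map (λ x → f x * n) xs) ≡ sum (map f xs) * n
sum-map-*ʳ f n []       = refl
sum-map-*ʳ f n (x ∷ xs) =
  trans (cong (f x * n +_) (sum-map-*ʳ f n xs)) (sym (*-distribʳ-+ n (f x) (sum (map f xs))))

sum-map-swap : ∀ (f : A → B → ℕ) xs ys →
               sum (map (λ x → sum (map (f x) ys)) xs) ≡ sum (map (λ y → sum (map (λ x → f x y) xs)) ys)
sum-map-swap f []       ys = sym (trans (sum-map-const 0 ys) (*-zeroʳ (length ys)))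
sum-map-swap f (x ∷ xs) ys =
  trans (cong (sum (map (f x) ys) +_) (sum-map-swap f xs ys))
        (sym (sum-map-+ (f x) (λ y → sum (map (λ x → f x y) xs)) ys))

sum-map-filter : ∀ {p} {P : Pred A p} (P? : Decidable P) (f : A → ℕ) xs →
                 sum (map (λ x → if does (P? x) then f x else 0) xs) ≡ sum (map f (filter P? xs))
sum-map-filter P? f []       = refl
sum-map-filter P? f (x ∷ xs) with does (P? x)
... | true  = cong (f x +_) (sum-map-filter P? f xs)
... | false = sum-map-filter P? f xs

sum-map-mono-≤ : ∀ {f g : A → ℕ} {xs} → All (λ x → f x ≤ g x) xs → sum (map f xs) ≤ sum (map g xs)
sum-map-mono-≤ []           = z≤n
sum-map-mono-≤ (fx≤gx ∷ ps) = +-mono-≤ fx≤gx (sum-map-mono-≤ ps)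

∈⇒≤sum-map : ∀ (f : A → ℕ) {x xs} → x ∈ xs → f x ≤ sum (map f xs)
∈⇒≤sum-map f (here refl)                = m≤m+n _ _
∈⇒≤sum-map f {xs = y ∷ _} (there x∈xs) = ≤-trans (∈⇒≤sum-map f x∈xs) (m≤n+m _ (f y))

length-allFin : ∀ n → length (allFin n) ≡ n
length-allFin n = length-tabulate id

Unique-⊆⇒length≤ : ∀ {xs ys : List A} → Unique xs → xs ⊆ ys → length xs ≤ length ys
Unique-⊆⇒length≤ {xs = []}     _            _     = z≤n
Unique-⊆⇒length≤ {xs = x ∷ xs} (x∉xs ∷ xs!) xs⊆ys
  with as , bs , refl ← ∈-∃++ (xs⊆ys (here refl)) =
  ≤-trans (s≤s (Unique-⊆⇒length≤ xs! xs⊆as++bs)) (≤-reflexive (sym (length-++-sucʳ as x bs)))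
  where
  xs⊆as++bs : xs ⊆ as ++ bs
  xs⊆as++bs {y} y∈xs with ∈-++⁻ as (xs⊆ys (there y∈xs))
  ... | inj₁ y∈as         = ∈-++⁺ˡ y∈as
  ... | inj₂ (here refl)  = contradiction refl (All.lookup x∉xs y∈xs)
  ... | inj₂ (there y∈bs) = ∈-++⁺ʳ as y∈bs

filter-≟-Unique : (_≟_ : DecidableEquality A) {x : A} {xs : List A} →
                  Unique xs → x ∈ xs → filter (_≟ x) xs ≡ [ x ]
filter-≟-Unique _≟_ {x} (x∉xs ∷ _) (here refl) =
  trans (filter-accept (_≟ x) refl)
        (cong (x ∷_) (filter-none (_≟ x) (All.map (λ x≢y y≡x → x≢y (sym y≡x)) x∉xs)))
filter-≟-Unique _≟_ {x} (y∉ys ∷ ys!) (there x∈ys) =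
  trans (filter-reject (_≟ x) (All.lookup y∉ys x∈ys))
        (filter-≟-Unique _≟_ ys! x∈ys)

AllPairs-map-under-All : ∀ {p r s} {P : Pred A p} {R : A → A → Set r} {S : A → A → Set s} →
                         (∀ {x y} → P x → P y → R x y → S x y) →
                         ∀ {xs} → All P xs → AllPairs R xs → AllPairs S xs
AllPairs-map-under-All h []         []         = []
AllPairs-map-under-All h (px ∷ pxs) (rx ∷ rxs) =
  All.zipWith (λ (py , r) → h px py r) (pxs , rx) ∷ AllPairs-map-under-All h pxs rxs

PartialColouring : Set a → ℕ → Set a
PartialColouring A k = A → Maybe (Fin k)

module _ {a} {A : Set a} {k : ℕ} where

  hole : Maybe (Fin k) → ℕ
  hole nothing  = 1
  hole (just _) = 0

  holes : PartialColouring A k → List A → ℕ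
  holes f xs = sum (map (hole ∘ f) xs)

  Clash : (f g : PartialColouring A k) → A → Set
  Clash f g x = ∃₂ λ c d → f x ≡ just c × g x ≡ just d × c ≢ d

  Compatible : Fin k → Maybe (Fin k) → Set
  Compatible c nothing  = ⊤
  Compatible c (just d) = c ≡ d

  compatible? : ∀ c m → Dec (Compatible c m)
  compatible? c nothing  = yes tt
  compatible? c (just d) = c ≟ d

  compatible⇒¬Clash : ∀ {c} {f g : PartialColouring A k} {x} →
                      Compatible c (f x) → Compatible c (g x) → ¬ Clash f g x
  compatible⇒¬Clash {c = c} cf cg (c₁ , c₂ , fx≡c₁ , gx≡c₂ , c₁≢c₂) =
    c₁≢c₂ (trans (sym (subst (Compatible c) fx≡c₁ cf)) (subst (Compatible c) gx≡c₂ cg))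

  k^holes-∷ : ∀ (f : PartialColouring A k) x xs →
              k ^ holes f (x ∷ xs) ≡
              sum (map (λ c → if does (compatible? c (f x)) then k ^ holes f xs else 0) (allFin k))
  k^holes-∷ f x xs with f x
  ... | nothing = sym (trans (sum-map-const w (allFin k)) (cong (_* w) (length-allFin k)))
    where w = k ^ holes f xs
  ... | just d  = sym (begin
    sum (map (λ c → if does (c ≟ d) then w else 0) (allFin k))  ≡⟨ sum-map-filter (_≟ d) (λ _ → w) (allFin k) ⟩
    sum (map (λ _ → w) (filter (_≟ d) (allFin k)))              ≡⟨ cong (sum ∘ map (λ _ → w))
                                                                      (filter-≟-Unique _≟_ (Unique.allFin⁺ k) (∈-allFin d)) ⟩
    w + 0                                                        ≡⟨ +-identityʳ w ⟩
    w                                                            ∎)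
    where
    open ≡-Reasoning
    w = k ^ holes f xs

  -- Split on the colour c at x: f contributes to every c compatible with f x,
  -- and the f compatible with a fixed c clash pairwise already on xs.
  kraft : ∀ (xs : List A) (fs : List (PartialColouring A k)) →
          AllPairs (λ f g → Any (Clash f g) xs) fs →
          sum (map (λ f → k ^ holes f xs) fs) ≤ k ^ length xs
  kraft []       []          _              = z≤n
  kraft []       (_ ∷ [])    _              = ≤-refl
  kraft []       (_ ∷ _ ∷ _) ((() ∷ _) ∷ _)
  kraft (x ∷ xs) fs          clashes        = begin
    sum (map (λ f → k ^ holes f (x ∷ xs)) fs)
      ≡⟨ cong sum (map-cong (λ f → k^holes-∷ f x xs) fs) ⟩
    sum (map (λ f → sum (map (λ c → if does (agrees? c f) then w f else 0) (allFin k))) fs)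
      ≡⟨ sum-map-swap _ fs (allFin k) ⟩
    sum (map (λ c → sum (map (λ f → if does (agrees? c f) then w f else 0) fs)) (allFin k))
      ≡⟨ cong sum (map-cong (λ c → sum-map-filter (agrees? c) w fs) (allFin k)) ⟩
    sum (map (λ c → sum (map w (filter (agrees? c) fs))) (allFin k))
      ≤⟨ sum-map-mono-≤ (All.universal (λ c → kraft xs _ (clashes-agreeing c)) (allFin k)) ⟩
    sum (map (λ _ → k ^ length xs) (allFin k))
      ≡⟨ trans (sum-map-const (k ^ length xs) (allFin k)) (cong (_* k ^ length xs) (length-allFin k)) ⟩
    k * k ^ length xs
      ∎
    where
    open ≤-Reasoning
    w : PartialColouring A k → ℕ
    w f = k ^ holes f xs
    agrees? : ∀ c (f : PartialColouring A k) → Dec (Compatible c (f x))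
    agrees? c f = compatible? c (f x)
    clashes-agreeing : ∀ c → AllPairs (λ f g → Any (Clash f g) xs) (filter (agrees? c) fs)
    clashes-agreeing c =
      AllPairs-map-under-All (λ {f} {g} cf cg → Any.tail (compatible⇒¬Clash {f = f} {g} {x} cf cg))
        (All.all-filter (agrees? c) fs) (AllPairs.filter⁺ (agrees? c) clashes)

  pairwiseClashing⇒length≤ : ∀ .{{_ : NonZero k}} n (xs : List A) (fs : List (PartialColouring A k)) →
                             AllPairs (λ f g → Any (Clash f g) xs) fs →
                             All (λ f → length xs ≤ holes f xs + n) fs →
                             length fs ≤ k ^ n
  pairwiseClashing⇒length≤ n xs fs clashes fewDefined =
    *-cancelʳ-≤ (length fs) (k ^ n) (k ^ length xs) {{m^n≢0 k (length xs)}} (begin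
      length fs * k ^ length xs                    ≡⟨ sum-map-const _ fs ⟨
      sum (map (λ _ → k ^ length xs) fs)           ≤⟨ sum-map-mono-≤ (All.map weight-bound fewDefined) ⟩
      sum (map (λ f → k ^ holes f xs * k ^ n) fs)  ≡⟨ sum-map-*ʳ (λ f → k ^ holes f xs) (k ^ n) fs ⟩
      sum (map (λ f → k ^ holes f xs) fs) * k ^ n  ≤⟨ *-monoˡ-≤ (k ^ n) (kraft xs fs clashes) ⟩
      k ^ length xs * k ^ n                        ≡⟨ *-comm (k ^ length xs) (k ^ n) ⟩
      k ^ n * k ^ length xs                        ∎)
    where
    open ≤-Reasoning
    weight-bound : ∀ {f} → length xs ≤ holes f xs + n → k ^ length xs ≤ k ^ holes f xs * k ^ n
    weight-bound {f} ≤holes+n =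
      ≤-trans (^-monoʳ-≤ k ≤holes+n) (≤-reflexive (^-distribˡ-+-* k (holes f xs) n))

module _ {k : ℕ} (vs : List ℕ) (col : ℕ → Fin k) where

  colourIn : PartialColouring ℕ k
  colourIn v with v ∈? vs
  ... | yes _ = just (col v)
  ... | no  _ = nothing

  colourIn-∈ : ∀ {v} → v ∈ vs → colourIn v ≡ just (col v)
  colourIn-∈ {v} v∈vs with v ∈? vs
  ... | yes _    = refl
  ... | no  v∉vs = contradiction v∈vs v∉vs

  length≡holes+coloured : ∀ ws → length ws ≡ holes colourIn ws + length (filter (_∈? vs) ws)
  length≡holes+coloured []       = refl
  length≡holes+coloured (w ∷ ws) with w ∈? vs
  ... | yes _ = trans (cong suc (length≡holes+coloured ws)) (sym (+-suc _ _))
  ... | no  _ = cong suc (length≡holes+coloured ws)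

  Unique⇒length≤holes-colourIn : ∀ {ws} → Unique ws → length ws ≤ holes colourIn ws + length vs
  Unique⇒length≤holes-colourIn {ws} ws! = begin
    length ws                                            ≡⟨ length≡holes+coloured ws ⟩
    holes colourIn ws + length (filter (_∈? vs) ws)      ≤⟨ +-monoʳ-≤ (holes colourIn ws) coloured≤ ⟩
    holes colourIn ws + length vs                        ∎
    where
    open ≤-Reasoning
    coloured≤ : length (filter (_∈? vs) ws) ≤ length vs
    coloured≤ = Unique-⊆⇒length≤ (Unique.filter⁺ (_∈? vs) ws!) (All.lookup (All.all-filter (_∈? vs) ws))

-- Positions counted from 0, so that the sequence is injective everywhere (π p 0 is junk).
shifted : InfPerm → ℕ → ℕ
shifted p j = π p (suc j)

shifted-injective : ∀ p {i j} → shifted p i ≡ shifted p j → i ≡ j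
shifted-injective p eq = suc-injective (inj p _ _ (s≤s z≤n) (s≤s z≤n) eq)

module _ (G : NaturalGraph) {k : ℕ} (col : ℕ → Fin k) (proper : ∀ {u v} → E G u v → col u ≢ col v) where

  trace : InfPerm → PartialColouring ℕ k
  trace p = colourIn (V G) col ∘ shifted p

  length≤holes-trace : ∀ p {js} → Unique js → length js ≤ holes (trace p) js + ∣V∣ G
  length≤holes-trace p {js} js! = begin
    length js                                                      ≡⟨ length-map (shifted p) js ⟨
    length (map (shifted p) js)                                    ≤⟨ Unique⇒length≤holes-colourIn (V G) col
                                                                        (Unique.map⁺ (shifted-injective p) js!) ⟩
    holes (colourIn (V G) col) (map (shifted p) js) + ∣V∣ G       ≡⟨ cong (λ h → sum h + ∣V∣ G) (map-∘ js) ⟨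
    holes (trace p) js + ∣V∣ G                                     ∎
    where open ≤-Reasoning

  trace-clash : ∀ p q j → E G (shifted p j) (shifted q j) → Clash (trace p) (trace q) j
  trace-clash p q j e = let u∈V , v∈V = E-in-V G e in
    col (shifted p j) , col (shifted q j) , colourIn-∈ (V G) col u∈V , colourIn-∈ (V G) col v∈V , proper e

  module _ {m : ℕ} (P : Fin m → InfPerm) (diff : ∀ a b → a ≢ b → GDifferent G (P a) (P b)) where

    -- Deciding a ≟ b here and in clashPosition-spec makes both use the same witness of diff.
    clashPosition : Fin m → Fin m → ℕ
    clashPosition a b with a ≟ b
    ... | yes _   = 0
    ... | no a≢b  = proj₁ (diff a b a≢b)

    clashPosition-spec : ∀ a b → a ≢ b →
                         ∃ λ j → suc j ≤ clashPosition a b × E G (shifted (P a) j) (shifted (P b) j)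
    clashPosition-spec a b a≢b with a ≟ b
    ... | yes a≡b = contradiction a≡b a≢b
    ... | no a≢b′ with diff a b a≢b′
    ...   | suc j , _ , e = j , ≤-refl , e

    horizon : ℕ
    horizon = sum (map (λ a → sum (map (clashPosition a) (allFin m))) (allFin m))

    clashPosition≤horizon : ∀ a b → clashPosition a b ≤ horizon
    clashPosition≤horizon a b =
      ≤-trans (∈⇒≤sum-map (clashPosition a) (∈-allFin b))
              (∈⇒≤sum-map (λ a → sum (map (clashPosition a) (allFin m))) (∈-allFin a))

    traces-clash : ∀ a b → a ≢ b → Any (Clash (trace (P a)) (trace (P b))) (upTo horizon)
    traces-clash a b a≢b = let j , sj≤clash , e = clashPosition-spec a b a≢b in
      lose (∈-upTo⁺ (≤-trans sj≤clash (clashPosition≤horizon a b))) (trace-clash (P a) (P b) j e)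

    GDifferent⇒≤k^∣V∣ : .{{NonZero k}} → m ≤ k ^ ∣V∣ G
    GDifferent⇒≤k^∣V∣ = subst (_≤ k ^ ∣V∣ G) (trans (length-map _ (allFin m)) (length-allFin m))
      (pairwiseClashing⇒length≤ (∣V∣ G) (upTo horizon) (map (trace ∘ P) (allFin m))
        (AllPairs.map⁺ (AllPairs.tabulate⁺ (traces-clash _ _)))
        (All.map⁺ (All.universal (λ a → length≤holes-trace (P a) (Unique.upTo⁺ horizon)) (allFin m))))

colouring⇒NonZero : ∀ {k} → (ℕ → Fin k) → NonZero k
colouring⇒NonZero {zero}  col with col 0
... | ()
colouring⇒NonZero {suc k} _ = _

lemma1 : (G : NaturalGraph) (χ : ℕ) → IsChromaticNumber G χ →
         (m : ℕ) (P : Fin m → InfPerm) →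
         (∀ a b → a ≢ b → GDifferent G (P a) (P b)) →
         m ≤ χ ^ ∣V∣ G
lemma1 G χ ((col , proper) , _) m P diff =
  GDifferent⇒≤k^∣V∣ G col proper P diff {{colouring⇒NonZero col}}
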